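{- A GM-move $x \to x'$ respects the inequality $n-k \le m(x)$: if $n-k \le m(x)$, then $n-k \le m(x')$.
   Context: Fix integers $n,k,\ell$ with $0<k<n$ and $1<\ell$, and an integer vector $x=(x_1,\ldots,x_n)$ with $x_1\le\cdots\le x_n$. Let $m(x)$ be the number of entries of $x$ that are multiples of $\ell$. Choose $n-k$ entries (bears): if $n-k\le m(x)$, the $n-k$ smallest entries that are multiples of $\ell$; if $n-k>m(x)$, all $m(x)$ such entries plus $n-k-m(x)$ others (e.g. the largest ones). Ties are broken by always choosing entries with the largest indices (the rightmost ones). A GM-move $x\to x'$ keeps the $n-k$ bearish entries unchanged and reduces each of the remaining $k$ (bullish) entries by $1$. -}

module Defs where

open import Data.Nat as ℕ using (ℕ; zero; suc; _∸_)
open import Data.Integer as ℤ using (ℤ; _-_; 1ℤ)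
open import Data.Integer.Properties as ℤP using ()
open import Data.Integer.Divisibility.Signed using (_∣_; _∣?_)
open import Data.Fin as Fin using (Fin)
open import Data.Fin.Properties as FinP using ()
open import Data.Bool using (Bool; true; false; if_then_else_; _∧_; _∨_; not)
open import Relation.Nullary.Decidable using (⌊_⌋)

count : ∀ {n} → (Fin n → Bool) → ℕ
count {zero}  p = 0
count {suc n} p = (if p Fin.zero then 1 else 0) ℕ.+ count (λ i → p (Fin.suc i))

Sorted : ∀ {n} → (Fin n → ℤ) → Set
Sorted x = ∀ i j → i Fin.≤ j → x i ℤ.≤ x j

isMult : ∀ {n} → ℤ → (Fin n → ℤ) → Fin n → Bool
isMult ℓ x i = ⌊ ℓ ∣? x i ⌋

m : ∀ {n} → ℤ → (Fin n → ℤ) → ℕ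
m ℓ x = count (isMult ℓ x)

-- "j comes before i" in the order "smaller value first, ties: larger index first"
-- (so taking an initial segment picks the smallest entries, rightmost on ties)
precedesSmall : ∀ {n} → (Fin n → ℤ) → Fin n → Fin n → Bool
precedesSmall x j i = ⌊ x j ℤP.<? x i ⌋ ∨ (⌊ x j ℤP.≟ x i ⌋ ∧ ⌊ i FinP.<? j ⌋)

-- "j comes before i" in the order "larger value first, ties: larger index first"
-- (initial segment = the largest entries, rightmost on ties)
precedesLarge : ∀ {n} → (Fin n → ℤ) → Fin n → Fin n → Bool
precedesLarge x j i = ⌊ x i ℤP.<? x j ⌋ ∨ (⌊ x j ℤP.≟ x i ⌋ ∧ ⌊ i FinP.<? j ⌋)

-- Case n-k ≤ m(x): the n-k smallest multiples of ℓ (ties: rightmost):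
--   i is a bear iff ℓ ∣ x_i and fewer than n-k multiples of ℓ precede it.
-- Case n-k > m(x): all multiples of ℓ plus the n-k-m(x) largest
--   non-multiples (ties: rightmost).
isBear : (n k : ℕ) → ℤ → (Fin n → ℤ) → Fin n → Bool
isBear n k ℓ x i with ⌊ (n ∸ k) ℕ.≤? m ℓ x ⌋
... | true  = isMult ℓ x i ∧
              ⌊ count (λ j → isMult ℓ x j ∧ precedesSmall x j i) ℕ.<? (n ∸ k) ⌋
... | false = isMult ℓ x i ∨
              ⌊ count (λ j → not (isMult ℓ x j) ∧ precedesLarge x j i)
                  ℕ.<? ((n ∸ k) ∸ m ℓ x) ⌋

gmMove : (n k : ℕ) → ℤ → (Fin n → ℤ) → (Fin n → ℤ)
gmMove n k ℓ x i = if isBear n k ℓ x i then x i else x i - 1ℤ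

-- When n - k ≤ m(x) the bears are the multiples of ℓ of rank below n - k, the rank of an entry
-- being the number of multiples of ℓ preceding it in a strict order.  Bears keep their value,
-- so it suffices that at least n - k multiples have rank below n - k.  If fewer did, some
-- multiple would have rank at least n - k, and then so would one of its predecessors, of
-- strictly smaller rank; this descent cannot go on forever.
module Submission where

open import Defs
open import Data.Nat using (ℕ; _<_; _≤_; _∸_)
open import Data.Integer using (ℤ; +_)
open import Data.Fin using (Fin)

open import Data.Nat using (zero; suc; z≤n; s≤s; _<?_; _≤?_)
open import Data.Nat.Properties using (≤-trans; <-≤-trans; ≮⇒≥; <⇒≱; m≤n⇒m≤1+n)
open import Data.Nat.Induction using (<-wellFounded)
import Data.Integer as ℤ
import Data.Integer.Properties as ℤP
import Data.Fin as Fin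
import Data.Fin.Properties as FinP
open import Data.Bool using (Bool; true; false; T; _∧_)
open import Data.Bool.Properties using (T-∧; T-∨)
open import Data.Empty using (⊥; ⊥-elim)
open import Data.Product using (_×_; _,_; ∃-syntax; proj₁; proj₂)
open import Data.Sum using (_⊎_; inj₁; inj₂)
open import Function using (_∘_; Equivalence)
open import Induction.WellFounded using (Acc; acc)
open import Relation.Nullary using (¬_; yes; no)
open import Relation.Nullary.Decidable using (⌊_⌋; T?; ¬?; _×-dec_; decidable-stable; toWitness; fromWitness)
open import Relation.Binary.PropositionalEquality using (_≡_; refl; sym; trans; subst)

open Equivalence using (to; from)

count-mono : ∀ {n} {p q : Fin n → Bool} → (∀ i → T (p i) → T (q i)) → count p ≤ count q
count-mono {zero} p⊆q = z≤n
count-mono {suc n} {p} {q} p⊆q with p Fin.zero | q Fin.zero | p⊆q Fin.zero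
... | false | false | _   = count-mono (p⊆q ∘ Fin.suc)
... | false | true  | _   = m≤n⇒m≤1+n (count-mono (p⊆q ∘ Fin.suc))
... | true  | true  | _   = s≤s (count-mono (p⊆q ∘ Fin.suc))
... | true  | false | 0⊆0 = ⊥-elim (0⊆0 _)

count-strictMono : ∀ {n} {p q : Fin n → Bool} → (∀ i → T (p i) → T (q i)) →
                   ∀ i → T (q i) → ¬ T (p i) → count p < count q
count-strictMono {suc n} {p} {q} p⊆q Fin.zero qi ¬pi with p Fin.zero | q Fin.zero
... | false | true  = s≤s (count-mono (p⊆q ∘ Fin.suc))
... | true  | _     = ⊥-elim (¬pi _)
count-strictMono {suc n} {p} {q} p⊆q (Fin.suc i) qi ¬pi
  with p Fin.zero | q Fin.zero | p⊆q Fin.zero | count-strictMono (p⊆q ∘ Fin.suc) i qi ¬pi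
... | false | false | _   | p′<q′ = p′<q′
... | false | true  | _   | p′<q′ = m≤n⇒m≤1+n p′<q′
... | true  | true  | _   | p′<q′ = s≤s p′<q′
... | true  | false | 0⊆0 | _     = ⊥-elim (0⊆0 _)

count<⇒∃-∖ : ∀ {n} (p q : Fin n → Bool) → count q < count p → ∃[ i ] T (p i) × ¬ T (q i)
count<⇒∃-∖ p q q<p with FinP.any? (λ i → T? (p i) ×-dec ¬? (T? (q i)))
... | yes p∖q = p∖q
... | no  p⊆q = ⊥-elim (<⇒≱ q<p (count-mono λ i pi →
                  decidable-stable (T? (q i)) (λ ¬qi → p⊆q (i , pi , ¬qi))))

module Rank {n : ℕ} (P : Fin n → Bool) (_≺_ : Fin n → Fin n → Bool)
  (≺-trans : ∀ {a b c} → T (a ≺ b) → T (b ≺ c) → T (a ≺ c))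
  (≺-irrefl : ∀ {a} → ¬ T (a ≺ a)) (t : ℕ) where

  rank : Fin n → ℕ
  rank i = count (λ j → P j ∧ j ≺ i)

  lowRank : Fin n → Bool
  lowRank i = P i ∧ ⌊ rank i <? t ⌋

  rank-strictMono : ∀ {j i} → T (P j) → T (j ≺ i) → rank j < rank i
  rank-strictMono {j} {i} Pj j≺i =
    count-strictMono below-j⊆below-i j (from T-∧ (Pj , j≺i)) (≺-irrefl ∘ proj₂ ∘ to T-∧)
    where
    below-j⊆below-i : ∀ l → T (P l ∧ l ≺ j) → T (P l ∧ l ≺ i)
    below-j⊆below-i l l<j = let (Pl , l≺j) = to T-∧ l<j in from T-∧ (Pl , ≺-trans l≺j j≺i)

  notLowRank⇒t≤rank : ∀ {i} → T (P i) → ¬ T (lowRank i) → t ≤ rank i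
  notLowRank⇒t≤rank Pi ¬low = ≮⇒≥ λ r<t → ¬low (from T-∧ (Pi , fromWitness r<t))

  no-descent : count lowRank < t → ∀ i → Acc _<_ (rank i) → T (P i) → t ≤ rank i → ⊥
  no-descent low<t i (acc rs) Pi t≤ri
    with count<⇒∃-∖ (λ j → P j ∧ j ≺ i) lowRank (<-≤-trans low<t t≤ri)
  ... | j , j-below-i , ¬low =
    let (Pj , j≺i) = to T-∧ j-below-i in
    no-descent low<t j (rs (rank-strictMono Pj j≺i)) Pj (notLowRank⇒t≤rank Pj ¬low)

  count-lowRank : t ≤ count P → t ≤ count lowRank
  count-lowRank t≤P = ≮⇒≥ λ low<t →
    let (i , Pi , ¬low) = count<⇒∃-∖ P lowRank (<-≤-trans low<t t≤P) in
    no-descent low<t i (<-wellFounded (rank i)) Pi (notLowRank⇒t≤rank Pi ¬low)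

module SmallestFirst {n : ℕ} (x : Fin n → ℤ) where

  _⊏_ : Fin n → Fin n → Set
  a ⊏ b = x a ℤ.< x b ⊎ (x a ≡ x b × b Fin.< a)

  ⊏-trans : ∀ {a b c} → a ⊏ b → b ⊏ c → a ⊏ c
  ⊏-trans         (inj₁ a<b)         (inj₁ b<c)         = inj₁ (ℤP.<-trans a<b b<c)
  ⊏-trans {a}     (inj₁ a<b)         (inj₂ (b≡c , _))   = inj₁ (subst (x a ℤ.<_) b≡c a<b)
  ⊏-trans {c = c} (inj₂ (a≡b , _))   (inj₁ b<c)         = inj₁ (subst (ℤ._< x c) (sym a≡b) b<c)
  ⊏-trans         (inj₂ (a≡b , b<a)) (inj₂ (b≡c , c<b)) = inj₂ (trans a≡b b≡c , FinP.<-trans c<b b<a)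

  ⊏-irrefl : ∀ {a} → ¬ a ⊏ a
  ⊏-irrefl (inj₁ a<a)       = ℤP.<-irrefl refl a<a
  ⊏-irrefl (inj₂ (_ , a<a)) = FinP.<-irrefl refl a<a

  precedesSmall⇒⊏ : ∀ {a b} → T (precedesSmall x a b) → a ⊏ b
  precedesSmall⇒⊏ {a} {b} p with to (T-∨ {⌊ x a ℤP.<? x b ⌋}) p
  ... | inj₁ a<b = inj₁ (toWitness a<b)
  ... | inj₂ tie = let (a≡b , b<a) = to (T-∧ {⌊ x a ℤP.≟ x b ⌋}) tie in
                   inj₂ (toWitness a≡b , toWitness b<a)

  ⊏⇒precedesSmall : ∀ {a b} → a ⊏ b → T (precedesSmall x a b)
  ⊏⇒precedesSmall {a} {b} (inj₁ a<b) = from (T-∨ {⌊ x a ℤP.<? x b ⌋}) (inj₁ (fromWitness a<b))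
  ⊏⇒precedesSmall {a} {b} (inj₂ (a≡b , b<a)) = from (T-∨ {⌊ x a ℤP.<? x b ⌋})
    (inj₂ (from (T-∧ {⌊ x a ℤP.≟ x b ⌋}) (fromWitness a≡b , fromWitness b<a)))

  precedesSmall-trans : ∀ {a b c} → T (precedesSmall x a b) → T (precedesSmall x b c) →
                        T (precedesSmall x a c)
  precedesSmall-trans p q = ⊏⇒precedesSmall (⊏-trans (precedesSmall⇒⊏ p) (precedesSmall⇒⊏ q))

  precedesSmall-irrefl : ∀ {a} → ¬ T (precedesSmall x a a)
  precedesSmall-irrefl = ⊏-irrefl ∘ precedesSmall⇒⊏

gmMove-keeps-bearish-multiples : ∀ n k ℓ (x : Fin n → ℤ) i →
  T (isBear n k ℓ x i) → T (isMult ℓ x i) → T (isMult ℓ (gmMove n k ℓ x) i)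
gmMove-keeps-bearish-multiples n k ℓ x i bear mult with isBear n k ℓ x i
... | true = mult

module EnoughMultiples (n k : ℕ) (ℓ : ℤ) (x : Fin n → ℤ) (enough : n ∸ k ≤ m ℓ x) where
  open SmallestFirst x
  open Rank (isMult ℓ x) (precedesSmall x) precedesSmall-trans precedesSmall-irrefl (n ∸ k)

  isBear≡lowRank : ∀ i → isBear n k ℓ x i ≡ lowRank i
  isBear≡lowRank i with (n ∸ k) ≤? m ℓ x
  ... | yes _       = refl
  ... | no  ¬enough = ⊥-elim (¬enough enough)

  gmMove-preserves-enough : n ∸ k ≤ m ℓ (gmMove n k ℓ x)
  gmMove-preserves-enough = ≤-trans (count-lowRank enough) (count-mono kept)
    where
    kept : ∀ i → T (lowRank i) → T (isMult ℓ (gmMove n k ℓ x) i)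
    kept i low = gmMove-keeps-bearish-multiples n k ℓ x i
      (subst T (sym (isBear≡lowRank i)) low) (proj₁ (to T-∧ low))

mainTheorem6 : (n k : ℕ) (ℓ : ℤ) (x : Fin n → ℤ) →
    0 < k → k < n → + 1 Data.Integer.< ℓ → Sorted x →
    n ∸ k ≤ m ℓ x → n ∸ k ≤ m ℓ (gmMove n k ℓ x)
mainTheorem6 n k ℓ x _ _ _ _ enough = EnoughMultiples.gmMove-preserves-enough n k ℓ x enough
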